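{- For any rooted spanning tree $T$ of depth $D$ on an $n$-element node set $\mathcal{V}$ and any $F\subseteq\mathcal{V}\times\mathcal{V}$ that respects $T$, $\mathrm{size}_T(F)\le\min\{D|F|,\ 2\sum_{a\in\mathcal{V}}|\mathrm{anc}_T(a)|^2\}$.
   Context: The depth of a rooted tree is the maximum number of nodes on a path starting at the root. $\mathrm{anc}_T(a)$ is the set of ancestors of $a$ in $T$, including $a$; $\mathrm{anc}_T(u,v)=\mathrm{anc}_T(u)\cap\mathrm{anc}_T(v)$. A pair $(a,b)$ respects $T$ if $a$ is an ancestor or a descendant of $b$; $F$ respects $T$ if all its pairs do. $\mathrm{size}_T(F)=\sum_{(a,b)\in F}|\mathrm{anc}_T(a,b)|$. -}

module Defs where

open import Data.Nat using (ℕ; zero; suc; _+_; _*_; _⊔_; _≤_)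
open import Data.Bool using (Bool; true; false; _∧_; _∨_; if_then_else_)
open import Data.Fin using (Fin; _≟_)
open import Data.List using (List; map; foldr; allFin; upTo)
open import Data.Nat.ListAction using (sum)
open import Data.Sum using (_⊎_)
open import Data.Product using (∃)
open import Relation.Nullary.Decidable using (does)
open import Relation.Binary.PropositionalEquality using (_≡_)

iter : ∀ {n} → (Fin n → Fin n) → ℕ → Fin n → Fin n
iter f zero    v = v
iter f (suc k) v = f (iter f k v)

-- A rooted spanning tree on the node set Fin n, given by a parent map.
-- The root is its own parent; every node reaches the root by following parents
-- (this forces acyclicity and connectivity).
record RootedTree (n : ℕ) : Set where
  field
    root        : Fin n
    parent      : Fin n → Fin n
    parent-root : parent root ≡ root
    reaches     : ∀ v → ∃ λ k → iter parent k v ≡ root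
open RootedTree public

ΣV : ∀ {n} → (Fin n → ℕ) → ℕ
ΣV {n} f = sum (map f (allFin n))

maxV : ∀ {n} → (Fin n → ℕ) → ℕ
maxV {n} f = foldr _⊔_ 0 (map f (allFin n))

anyBelow : ℕ → (ℕ → Bool) → Bool
anyBelow m p = foldr _∨_ false (map p (upTo m))

toℕB : Bool → ℕ
toℕB b = if b then 1 else 0

-- Since parent is a self-map of an n-element set, the orbit
-- {parent^k(a) | k ∈ ℕ} equals {parent^k(a) | k < n}, so the bound is harmless.
isAnc : ∀ {n} → RootedTree n → Fin n → Fin n → Bool
isAnc {n} T x a = anyBelow n (λ k → does (iter (parent T) k a ≟ x))

Ancestor : ∀ {n} → RootedTree n → Fin n → Fin n → Set
Ancestor T x a = isAnc T x a ≡ true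

ancCard : ∀ {n} → RootedTree n → Fin n → ℕ
ancCard T a = ΣV (λ x → toℕB (isAnc T x a))

ancCard2 : ∀ {n} → RootedTree n → Fin n → Fin n → ℕ
ancCard2 T a b = ΣV (λ x → toℕB (isAnc T x a ∧ isAnc T x b))

-- depth = max number of nodes on a root-to-node path = max_v |anc_T(v)|
depth : ∀ {n} → RootedTree n → ℕ
depth T = maxV (ancCard T)

PairSet : ℕ → Set
PairSet n = Fin n → Fin n → Bool

card : ∀ {n} → PairSet n → ℕ
card F = ΣV (λ a → ΣV (λ b → toℕB (F a b)))

Respects : ∀ {n} → RootedTree n → PairSet n → Set
Respects {n} T F = ∀ (a b : Fin n) → F a b ≡ true → Ancestor T a b ⊎ Ancestor T b a

sizeT : ∀ {n} → RootedTree n → PairSet n → ℕ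
sizeT T F = ΣV (λ a → ΣV (λ b → if F a b then ancCard2 T a b else 0))

-- In a pair (a, b) that respects T one node is an ancestor of the other, so
-- anc_T(a,b) is the ancestor set of the upper node and |anc_T(a,b)| ≤ D.  For
-- the second bound, |anc_T(a,b)| ≤ [a ≼ b]·|anc_T(b)| + [b ≼ a]·|anc_T(a)|, and
-- each of the two double sums on the right equals Σ_c |anc_T(c)|², since a node
-- c has exactly |anc_T(c)| ancestors.
module Submission where

open import Defs
open import Data.Nat using (ℕ; _*_; _^_; _≤_)
open import Data.Product using (_×_)
open import Relation.Binary.PropositionalEquality using (_≡_)

open import Data.Nat using (_+_; _⊔_; z≤n; s≤s)
open import Data.Nat.Properties
open import Algebra.Properties.CommutativeSemigroup +-commutativeSemigroup using (interchange)
open import Data.Nat.ListAction using (sum)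
open import Data.Bool using (Bool; true; false; _∧_; if_then_else_)
open import Data.Fin using (Fin)
open import Data.List using (List; []; _∷_; map; foldr; allFin)
open import Data.List.Membership.Propositional using (_∈_)
open import Data.List.Membership.Propositional.Properties using (∈-allFin)
open import Data.List.Relation.Unary.Any using (here; there)
open import Data.Product using (_,_)
open import Data.Sum using (_⊎_; inj₁; inj₂)
open import Relation.Binary.PropositionalEquality using (refl; sym; trans; cong; cong₂; module ≡-Reasoning)

private
  variable
    A B : Set

sum-map-mono : (xs : List A) {f g : A → ℕ} → (∀ x → f x ≤ g x) →
               sum (map f xs) ≤ sum (map g xs)
sum-map-mono []       f≤g = z≤n
sum-map-mono (x ∷ xs) f≤g = +-mono-≤ (f≤g x) (sum-map-mono xs f≤g)

sum-map-cong : (xs : List A) {f g : A → ℕ} → (∀ x → f x ≡ g x) →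
               sum (map f xs) ≡ sum (map g xs)
sum-map-cong []       f≡g = refl
sum-map-cong (x ∷ xs) f≡g = cong₂ _+_ (f≡g x) (sum-map-cong xs f≡g)

sum-map-+ : (xs : List A) (f g : A → ℕ) →
            sum (map (λ x → f x + g x) xs) ≡ sum (map f xs) + sum (map g xs)
sum-map-+ []       f g = refl
sum-map-+ (x ∷ xs) f g = trans (cong (f x + g x +_) (sum-map-+ xs f g))
                               (interchange (f x) (g x) (sum (map f xs)) (sum (map g xs)))

sum-map-*ˡ : (xs : List A) (c : ℕ) (f : A → ℕ) →
             sum (map (λ x → c * f x) xs) ≡ c * sum (map f xs)
sum-map-*ˡ []       c f = sym (*-zeroʳ c)
sum-map-*ˡ (x ∷ xs) c f = trans (cong (c * f x +_) (sum-map-*ˡ xs c f))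
                                (sym (*-distribˡ-+ c (f x) (sum (map f xs))))

sum-map-const-0 : (xs : List A) → sum (map (λ _ → 0) xs) ≡ 0
sum-map-const-0 []       = refl
sum-map-const-0 (_ ∷ xs) = sum-map-const-0 xs

sum-map-comm : (xs : List A) (ys : List B) (f : A → B → ℕ) →
               sum (map (λ x → sum (map (f x) ys)) xs) ≡ sum (map (λ y → sum (map (λ x → f x y) xs)) ys)
sum-map-comm []       ys f = sym (sum-map-const-0 ys)
sum-map-comm (x ∷ xs) ys f =
  trans (cong (sum (map (f x) ys) +_) (sum-map-comm xs ys f))
        (sym (sum-map-+ ys (f x) (λ y → sum (map (λ x → f x y) xs))))

if-then-0≡*toℕB : ∀ (b : Bool) c → (if b then c else 0) ≡ c * toℕB b
if-then-0≡*toℕB true  c = sym (*-identityʳ c)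
if-then-0≡*toℕB false c = sym (*-zeroʳ c)

sum-map-if : (xs : List A) (p : A → Bool) (c : ℕ) →
             sum (map (λ x → if p x then c else 0) xs) ≡ c * sum (map (λ x → toℕB (p x)) xs)
sum-map-if xs p c = trans (sum-map-cong xs (λ x → if-then-0≡*toℕB (p x) c))
                          (sum-map-*ˡ xs c (λ x → toℕB (p x)))

≤-foldr-⊔-map : (xs : List A) (f : A → ℕ) {x : A} → x ∈ xs → f x ≤ foldr _⊔_ 0 (map f xs)
≤-foldr-⊔-map (y ∷ xs) f (here refl) = m≤m⊔n (f y) _
≤-foldr-⊔-map (y ∷ xs) f (there x∈xs) = m≤n⇒m≤o⊔n (f y) (≤-foldr-⊔-map xs f x∈xs)

toℕB-∧-≤ˡ : ∀ x y → toℕB (x ∧ y) ≤ toℕB x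
toℕB-∧-≤ˡ false y     = z≤n
toℕB-∧-≤ˡ true  false = z≤n
toℕB-∧-≤ˡ true  true  = s≤s z≤n

toℕB-∧-≤ʳ : ∀ x y → toℕB (x ∧ y) ≤ toℕB y
toℕB-∧-≤ʳ false y = z≤n
toℕB-∧-≤ʳ true  y = ≤-refl

module _ {n : ℕ} (T : RootedTree n) where

  ancCard2≤ancCardˡ : ∀ a b → ancCard2 T a b ≤ ancCard T a
  ancCard2≤ancCardˡ a b = sum-map-mono (allFin n) (λ x → toℕB-∧-≤ˡ (isAnc T x a) (isAnc T x b))

  ancCard2≤ancCardʳ : ∀ a b → ancCard2 T a b ≤ ancCard T b
  ancCard2≤ancCardʳ a b = sum-map-mono (allFin n) (λ x → toℕB-∧-≤ʳ (isAnc T x a) (isAnc T x b))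

  ancCard≤depth : ∀ a → ancCard T a ≤ depth T
  ancCard≤depth a = ≤-foldr-⊔-map (allFin n) (ancCard T) (∈-allFin a)

  sizeT≤Σbound : (F : PairSet n) (g : Fin n → Fin n → ℕ) →
                 (∀ a b → F a b ≡ true → ancCard2 T a b ≤ g a b) →
                 sizeT T F ≤ ΣV (λ a → ΣV (λ b → if F a b then g a b else 0))
  sizeT≤Σbound F g bound = sum-map-mono (allFin n) (λ a → sum-map-mono (allFin n) (pointwise a))
    where
    pointwise : ∀ a b → (if F a b then ancCard2 T a b else 0) ≤ (if F a b then g a b else 0)
    pointwise a b with F a b in Fab
    ... | true  = bound a b Fab
    ... | false = z≤n

  sizeT≤depth*card : (F : PairSet n) → sizeT T F ≤ depth T * card F
  sizeT≤depth*card F = begin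
    sizeT T F                                                   ≤⟨ sizeT≤Σbound F (λ _ _ → depth T) bound ⟩
    ΣV (λ a → ΣV (λ b → if F a b then depth T else 0))          ≡⟨ sum-map-cong (allFin n) (λ a → sum-map-if (allFin n) (F a) (depth T)) ⟩
    ΣV (λ a → depth T * ΣV (λ b → toℕB (F a b)))                ≡⟨ sum-map-*ˡ (allFin n) (depth T) (λ a → ΣV (λ b → toℕB (F a b))) ⟩
    depth T * card F                                            ∎
    where
    open ≤-Reasoning
    bound : ∀ a b → F a b ≡ true → ancCard2 T a b ≤ depth T
    bound a b _ = ≤-trans (ancCard2≤ancCardˡ a b) (ancCard≤depth a)

  ancWeight : Fin n → Fin n → ℕ
  ancWeight a b = if isAnc T a b then ancCard T b else 0

  ancCard2≤ancWeight : ∀ a b → Ancestor T a b ⊎ Ancestor T b a →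
                       ancCard2 T a b ≤ ancWeight a b + ancWeight b a
  ancCard2≤ancWeight a b (inj₁ a≼b) rewrite a≼b =
    ≤-trans (ancCard2≤ancCardʳ a b) (m≤m+n (ancCard T b) (ancWeight b a))
  ancCard2≤ancWeight a b (inj₂ b≼a) rewrite b≼a =
    ≤-trans (ancCard2≤ancCardˡ a b) (m≤n+m (ancCard T a) (ancWeight a b))

  sum-ancWeight : ΣV (λ a → ΣV (λ b → ancWeight a b)) ≡ ΣV (λ c → ancCard T c ^ 2)
  sum-ancWeight = begin
    ΣV (λ a → ΣV (λ b → ancWeight a b))                    ≡⟨ sum-map-comm (allFin n) (allFin n) ancWeight ⟩
    ΣV (λ b → ΣV (λ a → ancWeight a b))                    ≡⟨ sum-map-cong (allFin n) (λ b → sum-map-if (allFin n) (λ a → isAnc T a b) (ancCard T b)) ⟩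
    ΣV (λ b → ancCard T b * ancCard T b)                   ≡⟨ sum-map-cong (allFin n) (λ b → cong (ancCard T b *_) (sym (*-identityʳ (ancCard T b)))) ⟩
    ΣV (λ c → ancCard T c ^ 2)                             ∎
    where open ≡-Reasoning

  sizeT≤2*sum-ancCard² : (F : PairSet n) → Respects T F →
                         sizeT T F ≤ 2 * ΣV (λ c → ancCard T c ^ 2)
  sizeT≤2*sum-ancCard² F respects = begin
    sizeT T F                                                                  ≤⟨ sizeT≤Σbound F g (λ a b Fab → ancCard2≤ancWeight a b (respects a b Fab)) ⟩
    ΣV (λ a → ΣV (λ b → if F a b then g a b else 0))                           ≤⟨ sum-map-mono (allFin n) (λ a → sum-map-mono (allFin n) (λ b → drop-if (F a b) (g a b))) ⟩
    ΣV (λ a → ΣV (λ b → g a b))                                                ≡⟨ sum-map-cong (allFin n) (λ a → sum-map-+ (allFin n) (ancWeight a) (λ b → ancWeight b a)) ⟩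
    ΣV (λ a → ΣV (ancWeight a) + ΣV (λ b → ancWeight b a))                     ≡⟨ sum-map-+ (allFin n) (λ a → ΣV (ancWeight a)) (λ a → ΣV (λ b → ancWeight b a)) ⟩
    ΣV (λ a → ΣV (ancWeight a)) + ΣV (λ a → ΣV (λ b → ancWeight b a))          ≡⟨ cong (ΣV (λ a → ΣV (ancWeight a)) +_) (sym (sum-map-comm (allFin n) (allFin n) ancWeight)) ⟩
    Q + Q                                                                      ≡⟨ cong₂ _+_ sum-ancWeight (trans sum-ancWeight (sym (+-identityʳ _))) ⟩
    2 * ΣV (λ c → ancCard T c ^ 2)                                             ∎
    where
    open ≤-Reasoning
    Q : ℕ
    Q = ΣV (λ a → ΣV (ancWeight a))
    g : Fin n → Fin n → ℕ
    g a b = ancWeight a b + ancWeight b a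
    drop-if : ∀ (c : Bool) m → (if c then m else 0) ≤ m
    drop-if true  m = ≤-refl
    drop-if false m = z≤n

lemma7p7 : ∀ (n D : ℕ) (T : RootedTree n) → depth T ≡ D → (F : PairSet n) → Respects T F →
    (sizeT T F ≤ D * card F) × (sizeT T F ≤ 2 * ΣV (λ a → ancCard T a ^ 2))
lemma7p7 n .(depth T) T refl F respects = sizeT≤depth*card T F , sizeT≤2*sum-ancCard² T F respects
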